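{- For every compact connected surface $S$ without boundary, there exists a quadrilateral tiling of $S$ that is (pentagonally) subdivisible and in which every tile is non-degenerate.
   Context: A tiling of a compact connected surface without boundary is a graph embedded in the surface such that the complementary regions (tiles) are homeomorphic to open disks; tilings are edge-to-edge, every vertex has degree at least $3$, and every tile has at least $3$ edges. A quadrilateral tiling is one in which every tile has $4$ edges (counted along its boundary). A polygon (tile) is non-degenerate if its boundary is a simple closed curve, and degenerate otherwise (some of its vertices and possibly edges are identified). A simple pentagonal subdivision of a quadrilateral tiling is obtained by placing a new vertex at the middle point of every edge and, inside each quadrilateral tile, joining by an arc the middle points of one of the two pairs of opposite edges of the tile, with the requirement that the middle point of each edge is used (as an endpoint of such an arc) exactly once; each quadrilateral is thereby cut into two pentagons. A quadrilateral tiling is (pentagonally) subdivisible if it admits a simple pentagonal subdivision. -}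

module Defs where

open import Data.Nat using (ℕ; zero; suc; _+_; _*_; _≤_)
open import Data.Fin using (Fin)
open import Data.Bool using (Bool)
open import Data.List using (List; []; _∷_)
open import Data.List.Membership.Propositional using (_∈_)
open import Data.Product using (Σ; _×_; ∃)
open import Function using (_∘_; Injective; Surjective; _⇔_)
open import Relation.Binary.PropositionalEquality using (_≡_; _≢_)
open import Relation.Nullary using (¬_)

-- Orb gs x y : y is reachable from x by applying generators from gs
-- (the generators used below are involutions, so this is the orbit relation).
data Orb {n : ℕ} (gs : List (Fin n → Fin n)) : Fin n → Fin n → Set where
  here : ∀ {x} → Orb gs x x
  step : ∀ {g x y} → g ∈ gs → Orb gs (g x) y → Orb gs x y

ClassCount : {n : ℕ} → (Fin n → Fin n → Set) → ℕ → Set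
ClassCount {n} R k =
  Σ (Fin n → Fin k) λ c → Surjective _≡_ _≡_ c × (∀ x y → (c x ≡ c y) ⇔ R x y)

ClassSize : {n : ℕ} → (Fin n → Fin n → Set) → Fin n → ℕ → Set
ClassSize {n} R x m =
  Σ (Fin m → Fin n) λ h → Injective _≡_ _≡_ h × (∀ y → R x y ⇔ ∃ λ i → h i ≡ y)

-- Maps (cellularly embedded graphs on closed connected surfaces) as flag
-- systems: s0 changes the vertex, s1 the edge, s2 the tile of a flag.

record FlagMap (n : ℕ) : Set where
  field
    s0 s1 s2 : Fin n → Fin n
    s0-invol : ∀ f → s0 (s0 f) ≡ f
    s1-invol : ∀ f → s1 (s1 f) ≡ f
    s2-invol : ∀ f → s2 (s2 f) ≡ f
    s0-fpf : ∀ f → s0 f ≢ f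
    s1-fpf : ∀ f → s1 f ≢ f
    s2-fpf : ∀ f → s2 f ≢ f
    s02-comm : ∀ f → s0 (s2 f) ≡ s2 (s0 f)
    s02-fpf : ∀ f → s0 (s2 f) ≢ f
    connected : ∀ f g → Orb (s0 ∷ s1 ∷ s2 ∷ []) f g

module _ {n : ℕ} (M : FlagMap n) where
  open FlagMap M

  SameVertex SameEdge SameTile : Fin n → Fin n → Set
  SameVertex = Orb (s1 ∷ s2 ∷ [])
  SameEdge   = Orb (s0 ∷ s2 ∷ [])
  SameTile   = Orb (s0 ∷ s1 ∷ [])

  -- a vertex of degree d has 2d flags; a tile with k edges (counted along
  -- its boundary) has 2k flags
  IsTiling : Set
  IsTiling =
    (∀ f m → ClassSize SameVertex f m → 6 ≤ m) ×
    (∀ f m → ClassSize SameTile f m → 6 ≤ m)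

  Quadrilateral : Set
  Quadrilateral = ∀ f → ClassSize SameTile f 8

  Orientable : Set
  Orientable = Σ (Fin n → Bool) λ c →
    (∀ f → c (s0 f) ≢ c f) × (∀ f → c (s1 f) ≢ c f) × (∀ f → c (s2 f) ≢ c f)

  -- walking around the tile of f: ρ f is the flag at the next corner / side
  ρ : Fin n → Fin n
  ρ = s1 ∘ s0

  ρ^ : ℕ → Fin n → Fin n
  ρ^ zero    f = f
  ρ^ (suc i) f = ρ (ρ^ i f)

  -- (for a quadrilateral tile) the boundary is a simple closed curve:
  -- its four corners are distinct vertices and its four sides distinct edges
  NonDegenerateTile : Fin n → Set
  NonDegenerateTile f = ∀ (i j : Fin 4) → i ≢ j →
    ¬ SameVertex (ρ^ (Data.Fin.toℕ i) f) (ρ^ (Data.Fin.toℕ j) f) ×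
    ¬ SameEdge   (ρ^ (Data.Fin.toℕ i) f) (ρ^ (Data.Fin.toℕ j) f)

  AllTilesNonDegenerate : Set
  AllTilesNonDegenerate = ∀ f → NonDegenerateTile f

  -- An edge-side of a tile is a pair
  -- {f, s0 f}; sel marks the edge-sides whose midpoint is an endpoint of the
  -- arc drawn inside that tile.  Inside each (quadrilateral) tile the marked
  -- sides are one of the two pairs of opposite sides (adjacent sides differ,
  -- opposite sides agree), and every edge midpoint is used exactly once
  -- (exactly one of the two edge-sides {f,s0 f}, {s2 f, s0 (s2 f)} marked).
  SimplePentagonalSubdivision : Set
  SimplePentagonalSubdivision = Σ (Fin n → Bool) λ sel →
    (∀ f → sel (s0 f) ≡ sel f) ×
    (∀ f → sel (s1 f) ≢ sel f) ×
    (∀ f → sel (ρ^ 2 f) ≡ sel f) ×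
    (∀ f → sel (s2 f) ≢ sel f)

  Subdivisible : Set
  Subdivisible = SimplePentagonalSubdivision

-- Compact connected surfaces without boundary, up to homeomorphism
-- (classification theorem): the orientable surface of genus g, and the
-- non-orientable surface with (suc k) cross-caps.

data Surface : Set where
  orientable    : (g : ℕ) → Surface
  nonorientable : (k : ℕ) → Surface

-- The surface underlying the map M is S: V - E + F = χ(S) and the
-- orientability matches.
_IsMapOn_ : {n : ℕ} → FlagMap n → Surface → Set
_IsMapOn_ M S =
  Σ ℕ λ V → Σ ℕ λ E → Σ ℕ λ F →
    ClassCount (SameVertex M) V × ClassCount (SameEdge M) E ×
    ClassCount (SameTile M) F × Cond V E F S
  where
  Cond : ℕ → ℕ → ℕ → Surface → Set
  Cond V E F (orientable g)    = Orientable M × (V + F + 2 * g ≡ E + 2)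
  Cond V E F (nonorientable k) = ¬ Orientable M × (V + F + suc k ≡ E + 2)

module Submission where

open import Defs
open import Data.Nat using (ℕ; suc)
open import Data.Product using (Σ; _×_)

-- Every surface is realised by squares glued along their sides: the cube for the sphere, the
-- hemicube for the projective plane, and otherwise the (n + 1)-fold cyclic cover of two squares
-- glued into a sphere (the pillow) or into a projective plane, branched over the corners around
-- which the gluing shifts the level.  Such a corner lifts to a single vertex of degree 2(n + 1),
-- every other vertex, every edge and every square to n + 1 copies, which gives the Euler
-- characteristic: the pillow cover has genus n, the twisted one n + 1 cross-caps.  Squares lift
-- isomorphically, so non-degeneracy, the pairs of opposite sides joined by the subdividing arcs
-- and the orientation (or an odd closed walk) come from the base.  All facts about the finite
-- base, including its orbits under the vertex, edge and connectivity generators, are decided by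
-- computation.

open import Agda.Builtin.FromNat using (Number; fromNat)
open import Data.Bool using (Bool; true; false; not; _xor_; if_then_else_)
import Data.Bool.Properties as Boolₚ
open import Data.Bool.ListAction using (any)
open import Data.Empty using (⊥; ⊥-elim)
open import Data.Fin using (Fin; zero; suc; fromℕ; inject₁; toℕ)
open import Data.Fin.Induction using (<-weakInduction)
import Data.Fin.Literals
open import Data.Fin.Patterns using (0F; 1F; 2F; 3F)
import Data.Fin.Properties as Finₚ
open import Data.Fin.Relation.Unary.Top using (view; ‵fromℕ; ‵inj₁; view-fromℕ; view-inject₁)
open import Data.List using (List; []; _∷_; _++_; map; length; lookup; allFin; concatMap; mapMaybe; head; take)
open import Data.List.Membership.Propositional using (_∈_)
open import Data.List.Membership.Propositional.Properties using (∈-map⁺; ∈-map⁻; ∈-lookup)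
open import Data.List.Relation.Unary.All as All using (All; []; _∷_)
open import Data.List.Relation.Unary.Any using (here; there)
open import Data.Maybe using (Maybe; just; nothing; _>>=_; fromMaybe)
import Data.Maybe as Maybe
import Data.Maybe.Properties as Maybeₚ
open import Data.Nat using (_+_; _*_; _≤_; NonZero; nonZero)
import Data.Nat.Literals
open import Data.Nat.GeneralisedArithmetic using (fold)
import Data.Nat.Properties as ℕₚ
open import Data.Nat.Tactic.RingSolver using (solve-∀)
open import Data.Product using (_,_; proj₁; proj₂; ∃)
open import Data.Product.Function.NonDependent.Propositional using (_×-↔_)
import Data.Product.Properties as Productₚ
open import Data.Sum using (_⊎_; inj₁; inj₂)
open import Data.Sum.Function.Propositional using (_⊎-↔_)
import Data.Sum.Properties as Sumₚ
open import Data.Unit using (⊤; tt)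
open import Data.Vec as Vec using (Vec; []; _∷_)
open import Function using (_∘_; _⇔_; mk⇔; _↔_; Inverse; Injective)
open import Function.Bundles using (Equivalence; Injection)
open import Function.Properties.Inverse using (↔⇒↣; ↔-refl; ↔-sym; ↔-trans)
open import Relation.Binary.Construct.Closure.ReflexiveTransitive as Star using (Star; ε; _◅_; _◅◅_)
open import Relation.Binary.Definitions using (DecidableEquality)
open import Relation.Binary.PropositionalEquality
open import Relation.Nullary using (Dec; yes; no; does; ¬_)
open import Relation.Nullary.Decidable using (True; toWitness; from-yes; _×-dec_; _⊎-dec_; map′; ¬?)
open ≡-Reasoning

private
  variable
    n r : ℕ

instance
  natNumber : Number ℕ
  natNumber = Data.Nat.Literals.number

  finNumber : Number (Fin n)
  finNumber {n} = Data.Fin.Literals.number n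

csuc cpred : Fin (suc n) → Fin (suc n)
csuc i with view i
... | ‵fromℕ          = zero
... | ‵inj₁ {i = j} _ = suc j

cpred zero    = fromℕ _
cpred (suc j) = inject₁ j

csuc-cpred : (i : Fin (suc n)) → csuc (cpred i) ≡ i
csuc-cpred {n} zero rewrite view-fromℕ n   = refl
csuc-cpred (suc j)  rewrite view-inject₁ j = refl

cpred-csuc : (i : Fin (suc n)) → cpred (csuc i) ≡ i
cpred-csuc i with view i
... | ‵fromℕ  = refl
... | ‵inj₁ _ = refl

csuc-irrefl : (i : Fin (suc (suc n))) → csuc i ≢ i
csuc-irrefl i eq with view i
... | ‵fromℕ          = Finₚ.0≢1+n eq
... | ‵inj₁ {i = j} _ = ℕₚ.1+n≢n (trans (cong toℕ eq) (Finₚ.toℕ-inject₁ j))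

data Shift : Set where
  down stay up : Shift

_≟ˢ_ : DecidableEquality Shift
down ≟ˢ down = yes refl
stay ≟ˢ stay = yes refl
up   ≟ˢ up   = yes refl
down ≟ˢ stay = no λ ()
down ≟ˢ up   = no λ ()
stay ≟ˢ down = no λ ()
stay ≟ˢ up   = no λ ()
up   ≟ˢ down = no λ ()
up   ≟ˢ stay = no λ ()

shift : Shift → Fin (suc n) → Fin (suc n)
shift down = cpred
shift stay = λ t → t
shift up   = csuc

_⁻¹ : Shift → Shift
down ⁻¹ = up
stay ⁻¹ = stay
up   ⁻¹ = down

shift-⁻¹ : ∀ d (t : Fin (suc n)) → shift (d ⁻¹) (shift d t) ≡ t
shift-⁻¹ down = csuc-cpred
shift-⁻¹ stay = λ _ → refl
shift-⁻¹ up   = cpred-csuc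

_⊕_ : Shift → Shift → Maybe Shift
stay ⊕ d    = just d
down ⊕ stay = just down
down ⊕ up   = just stay
up   ⊕ stay = just up
up   ⊕ down = just stay
down ⊕ down = nothing
up   ⊕ up   = nothing

shift-⊕ : ∀ d a {b} (t : Fin (suc n)) → d ⊕ a ≡ just b → shift a (shift d t) ≡ shift b t
shift-⊕ stay a    t refl = refl
shift-⊕ down stay t refl = refl
shift-⊕ down up   t refl = csuc-cpred t
shift-⊕ up   stay t refl = refl
shift-⊕ up   down t refl = cpred-csuc t

levelsApart : ℕ → Shift → Shift → Bool
levelsApart 0       _    _    = false
levelsApart (suc _) down stay = true
levelsApart (suc _) stay down = true
levelsApart (suc _) stay up   = true
levelsApart (suc _) up   stay = true
levelsApart (suc _) _    _    = false

shift-apart : ∀ a b (t : Fin (suc n)) → levelsApart n a b ≡ true → shift a t ≢ shift b t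
shift-apart {suc _} down stay t _ eq = csuc-irrefl t (trans (cong csuc (sym eq)) (csuc-cpred t))
shift-apart {suc _} stay down t _ eq = csuc-irrefl t (trans (cong csuc eq) (csuc-cpred t))
shift-apart {suc _} stay up   t _ eq = csuc-irrefl t (sym eq)
shift-apart {suc _} up   stay t _ eq = csuc-irrefl t eq

Step : {X : Set} → List (X → X) → X → X → Set
Step gs x y = ∃ λ g → g ∈ gs × g x ≡ y

Orbit : {X : Set} → List (X → X) → X → X → Set
Orbit gs = Star (Step gs)

Involutions : {X : Set} → List (X → X) → Set
Involutions gs = ∀ {g} → g ∈ gs → ∀ x → g (g x) ≡ x

orbit-sym : {X : Set} {gs : List (X → X)} → Involutions gs → ∀ {x y} → Orbit gs x y → Orbit gs y x
orbit-sym inv = Star.reverse λ { (g , g∈ , refl) → g , g∈ , inv g∈ _ }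

orb⇔orbit : ∀ {gs : List (Fin n → Fin n)} {i j} → Orb gs i j ⇔ Orbit gs i j
orb⇔orbit = mk⇔ to from
  where
  to : ∀ {gs i j} → Orb gs i j → Orbit gs i j
  to here        = ε
  to (step g∈ o) = (_ , g∈ , refl) ◅ to o
  from : ∀ {gs i j} → Orbit gs i j → Orb gs i j
  from ε                     = here
  from ((g , g∈ , refl) ◅ o) = step g∈ (from o)

record OrbitLabelling {X : Set} (gs : List (X → X)) (L : Set) : Set where
  field
    label           : X → L
    rep             : L → X
    label-invariant : ∀ {g} → g ∈ gs → ∀ x → label (g x) ≡ label x
    label-rep       : ∀ l → label (rep l) ≡ l
    reaches-rep     : ∀ x → Orbit gs x (rep (label x))

  orbit⇒label : ∀ {x y} → Orbit gs x y → label x ≡ label y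
  orbit⇒label ε                     = refl
  orbit⇒label ((g , g∈ , refl) ◅ o) = trans (sym (label-invariant g∈ _)) (orbit⇒label o)

  label⇒orbit : Involutions gs → ∀ {x y} → label x ≡ label y → Orbit gs x y
  label⇒orbit inv {x} {y} eq =
    reaches-rep x ◅◅ subst (λ l → Orbit gs (rep l) y) (sym eq) (orbit-sym inv (reaches-rep y))

module Transport {X : Set} {K : ℕ} (e : X ↔ Fin K) where
  open Inverse e using (to; from; strictlyInverseˡ; strictlyInverseʳ)

  to-injective : ∀ {x y} → to x ≡ to y → x ≡ y
  to-injective = Injection.injective (↔⇒↣ e)

  conj : (X → X) → Fin K → Fin K
  conj g = to ∘ g ∘ from

  conj-to : ∀ g x → conj g (to x) ≡ to (g x)
  conj-to g x = cong (to ∘ g) (strictlyInverseʳ x)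

  from-conj : ∀ g i → from (conj g i) ≡ g (from i)
  from-conj g i = strictlyInverseʳ (g (from i))

  conj-∘ : ∀ g h i → conj g (conj h i) ≡ to (g (h (from i)))
  conj-∘ g h i = conj-to g (h (from i))

  conj-involutive : ∀ g → (∀ x → g (g x) ≡ x) → ∀ i → conj g (conj g i) ≡ i
  conj-involutive g inv i = trans (conj-∘ g g i) (trans (cong to (inv (from i))) (strictlyInverseˡ i))

  conj-commute : ∀ g h → (∀ x → g (h x) ≡ h (g x)) → ∀ i → conj g (conj h i) ≡ conj h (conj g i)
  conj-commute g h comm i = trans (conj-∘ g h i) (trans (cong to (comm (from i))) (sym (conj-∘ h g i)))

  conj-irrefl : ∀ g → (∀ x → g x ≢ x) → ∀ i → conj g i ≢ i
  conj-irrefl g irr i eq = irr (from i) (to-injective (trans eq (sym (strictlyInverseˡ i))))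

  conj-∘-irrefl : ∀ g h → (∀ x → g (h x) ≢ x) → ∀ i → conj g (conj h i) ≢ i
  conj-∘-irrefl g h irr i eq =
    irr (from i) (to-injective (trans (sym (conj-∘ g h i)) (trans eq (sym (strictlyInverseˡ i)))))

  module _ {gs : List (X → X)} where
    orbit-to : ∀ {x y} → Orbit gs x y → Orb (map conj gs) (to x) (to y)
    orbit-to = Equivalence.from orb⇔orbit ∘ Star.gmap to λ where
      (g , g∈ , refl) → conj g , ∈-map⁺ conj g∈ , conj-to g _

    orbit-from : ∀ {i j} → Orb (map conj gs) i j → Orbit gs (from i) (from j)
    orbit-from = Star.gmap from from-step ∘ Equivalence.to orb⇔orbit
      where
      from-step : ∀ {i j} → Step (map conj gs) i j → Step gs (from i) (from j)
      from-step (h , h∈ , refl) with ∈-map⁻ conj h∈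
      ... | g , g∈ , refl = g , g∈ , sym (strictlyInverseʳ _)

    module _ {L} (inv : Involutions gs) (lab : OrbitLabelling gs L) where
      open OrbitLabelling lab

      orb⇔label : ∀ i j → Orb (map conj gs) i j ⇔ label (from i) ≡ label (from j)
      orb⇔label i j = mk⇔ (orbit⇒label ∘ orbit-from) λ eq →
        subst₂ (Orb (map conj gs)) (strictlyInverseˡ i) (strictlyInverseˡ j) (orbit-to (label⇒orbit inv eq))

      classCount : ∀ {V} → L ↔ Fin V → ClassCount (Orb (map conj gs)) V
      classCount ℓ = ℓ.to ∘ label ∘ from , surjective , λ i j →
        mk⇔ (Equivalence.from (orb⇔label i j) ∘ Injection.injective (↔⇒↣ ℓ))
            (cong ℓ.to ∘ Equivalence.to (orb⇔label i j))
        where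
        module ℓ = Inverse ℓ
        surjective : ∀ v → ∃ λ i → ∀ {j} → j ≡ i → ℓ.to (label (from j)) ≡ v
        surjective v = to (rep (ℓ.from v)) , λ where
          refl → trans (cong (ℓ.to ∘ label) (strictlyInverseʳ _))
                       (trans (cong ℓ.to (label-rep _)) (ℓ.strictlyInverseˡ v))

classSize-≥ : ∀ {K a m} {R : Fin K → Fin K → Set} {f} → ClassSize R f m →
              (w : Fin a → Fin K) → Injective _≡_ _≡_ w → (∀ k → R f (w k)) → a ≤ m
classSize-≥ {a = a} {m} (h , _ , members) w w-injective related = Finₚ.injective⇒≤ slot-injective
  where
  slot : Fin a → Fin m
  slot k = proj₁ (Equivalence.to (members (w k)) (related k))
  slot-injective : Injective _≡_ _≡_ slot
  slot-injective {k} {k′} eq =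
    w-injective (trans (sym (proj₂ (Equivalence.to (members (w k)) (related k))))
                       (trans (cong h eq) (proj₂ (Equivalence.to (members (w k′)) (related k′)))))

ρ²-preserves : ∀ {K} (M : FlagMap K) (c : Fin K → Bool) → (∀ f → c (FlagMap.s0 M f) ≡ c f) →
               (∀ f → c (FlagMap.s1 M f) ≢ c f) → ∀ f → c (ρ^ M 2 f) ≡ c f
ρ²-preserves M c s0-keeps s1-flips f =
  trans (ρ-flips (ρ M f)) (trans (cong not (ρ-flips f)) (Boolₚ.not-involutive (c f)))
  where
  ρ-flips : ∀ f → c (ρ M f) ≡ not (c f)
  ρ-flips f = trans (Boolₚ.¬-not (s1-flips (FlagMap.s0 M f))) (cong not (s0-keeps f))

-- Cyclic covers

record Voltaged (A : Set) : Set where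
  field
    perm : A → A
    volt : A → Shift
open Voltaged public

VoltagedInvolution : {A : Set} → Voltaged A → Set
VoltagedInvolution σ = ∀ a → perm σ (perm σ a) ≡ a × volt σ (perm σ a) ≡ volt σ a ⁻¹

Word : {A : Set} → List (Voltaged A) → Set
Word gs = List (Fin (length gs))

module _ {A : Set} (gs : List (Voltaged A)) where
  walk : Word gs → A → A
  walk []      a = a
  walk (i ∷ w) a = walk w (perm (lookup gs i) a)

  voltage : Word gs → A → Maybe Shift
  voltage []      a = just stay
  voltage (i ∷ w) a = voltage w (perm σ a) >>= (volt σ a ⊕_)
    where σ : Voltaged A
          σ = lookup gs i

-- The orbit of a base flag under the lifted maps is either the whole preimage of its base
-- orbit (a global class, inj₁) or one of n + 1 disjoint lifts of it (a local class, inj₂;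
-- the shift carries the flag's level to the level at which its path reaches the class
-- representative).
Kind : ℕ → ℕ → Set
Kind g l = Fin g ⊎ (Fin l × Shift)

Consistent : ∀ {g l} → Kind g l → Shift → Kind g l → Set
Consistent (inj₁ c)       v (inj₁ c′)        = c ≡ c′
Consistent (inj₂ (c , d)) v (inj₂ (c′ , d′)) = c ≡ c′ × v ⊕ d′ ≡ just d
Consistent _              _ _                = ⊥

module _ {A : Set} (gs : List (Voltaged A)) {g l} (grep : Fin g → A) (lrep : Fin l → A) where
  Leads : Kind g l → Word gs → A → Set
  Leads (inj₁ c)       w a = walk gs w a ≡ grep c
  Leads (inj₂ (c , d)) w a = walk gs w a ≡ lrep c × voltage gs w a ≡ just d

record Certificate {A : Set} (gs : List (Voltaged A)) : Set where
  field
    #global #local  : ℕ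
    grep            : Fin #global → A
    lrep            : Fin #local → A
    loop            : Fin #global → Word gs
    kind            : A → Kind #global #local
    path            : A → Word gs
    kind-consistent : All (λ σ → ∀ a → Consistent (kind a) (volt σ a) (kind (perm σ a))) gs
    path-leads      : ∀ a → Leads gs grep lrep (kind a) (path a) a
    loop-lowers     : ∀ c → walk gs (loop c) (grep c) ≡ grep c × voltage gs (loop c) (grep c) ≡ just down
    grep-kind       : ∀ c → kind (grep c) ≡ inj₁ c
    lrep-kind       : ∀ c → kind (lrep c) ≡ inj₂ (c , stay)

Label : ℕ → ℕ → ℕ → Set
Label n g l = Fin g ⊎ (Fin l × Fin (suc n))

labelOf : ∀ {g l} → Kind g l → Fin (suc n) → Label n g l
labelOf (inj₁ c)       t = inj₁ c
labelOf (inj₂ (c , d)) t = inj₂ (c , shift d t)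

labelOf-consistent : ∀ {g l} (κ : Kind g l) v κ′ (t : Fin (suc n)) → Consistent κ v κ′ →
                     labelOf κ′ (shift v t) ≡ labelOf κ t
labelOf-consistent (inj₁ c)       v (inj₁ c′)        t refl        = refl
labelOf-consistent (inj₂ (c , d)) v (inj₂ (c′ , d′)) t (refl , eq) = cong (λ s → inj₂ (c , s)) (shift-⊕ v d′ t eq)

KindsApart : ∀ {g l} → ℕ → Kind g l → Kind g l → Set
KindsApart n (inj₁ c)       (inj₁ c′)        = c ≢ c′
KindsApart n (inj₂ (c , d)) (inj₂ (c′ , d′)) = c ≢ c′ ⊎ levelsApart n d d′ ≡ true
KindsApart n _              _                = ⊤

labelOf-apart : ∀ {g l} (κ κ′ : Kind g l) (t : Fin (suc n)) → KindsApart n κ κ′ → labelOf κ t ≢ labelOf κ′ t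
labelOf-apart (inj₁ c)       (inj₁ c′)        t c≢c′        refl = c≢c′ refl
labelOf-apart (inj₂ (c , d)) (inj₂ (c′ , d′)) t (inj₁ c≢c′) eq   =
  c≢c′ (cong (λ { (inj₁ _) → c ; (inj₂ (c″ , _)) → c″ }) eq)
labelOf-apart (inj₂ (c , d)) (inj₂ (c′ , d′)) t (inj₂ apart) eq  =
  shift-apart d d′ t apart (cong (λ { (inj₁ _) → t ; (inj₂ (_ , s)) → s }) eq)

VoltagesApart : ℕ → Maybe Shift → Maybe Shift → Set
VoltagesApart n (just d) (just d′) = levelsApart n d d′ ≡ true
VoltagesApart n _        _         = ⊥

module Cover (n : ℕ) {A : Set} where
  lift : Voltaged A → A × Fin (suc n) → A × Fin (suc n)
  lift σ (a , t) = perm σ a , shift (volt σ a) t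

  lift-involutive : ∀ σ → VoltagedInvolution σ → ∀ x → lift σ (lift σ x) ≡ x
  lift-involutive σ inv (a , t) with inv a
  ... | perm² , volt-perm rewrite perm² | volt-perm = cong (a ,_) (shift-⁻¹ (volt σ a) t)

  lifts-involutive : ∀ {gs} → All VoltagedInvolution gs → Involutions (map lift gs)
  lifts-involutive invs g∈ with ∈-map⁻ lift g∈
  ... | σ , σ∈ , refl = lift-involutive σ (All.lookup invs σ∈)

  module _ (gs : List (Voltaged A)) where
    travel : Word gs → A × Fin (suc n) → A × Fin (suc n)
    travel []      x = x
    travel (i ∷ w) x = travel w (lift (lookup gs i) x)

    travel-orbit : ∀ w x → Orbit (map lift gs) x (travel w x)
    travel-orbit []      x = ε
    travel-orbit (i ∷ w) x = (_ , ∈-map⁺ lift (∈-lookup i) , refl) ◅ travel-orbit w _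

    travel-base : ∀ w a t → proj₁ (travel w (a , t)) ≡ walk gs w a
    travel-base []      a t = refl
    travel-base (i ∷ w) a t = travel-base w _ _

    travel-lands : ∀ w a t {d} → voltage gs w a ≡ just d → travel w (a , t) ≡ (walk gs w a , shift d t)
    travel-lands []      a t refl = refl
    travel-lands (i ∷ w) a t {d} eq with voltage gs w (perm (lookup gs i) a) in eq′
    ... | just d′ = trans (travel-lands w _ _ eq′) (cong (walk gs w _ ,_) (shift-⊕ (volt (lookup gs i) a) d′ t eq))

    Separated : Word gs → Word gs → A → Set
    Separated w w′ a = walk gs w a ≢ walk gs w′ a ⊎ VoltagesApart n (voltage gs w a) (voltage gs w′ a)

    separated⇒distinct : ∀ w w′ a t → Separated w w′ a → travel w (a , t) ≢ travel w′ (a , t)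
    separated⇒distinct w w′ a t (inj₁ walks≢) eq =
      walks≢ (trans (sym (travel-base w a t)) (trans (cong proj₁ eq) (travel-base w′ a t)))
    separated⇒distinct w w′ a t (inj₂ apart) eq with voltage gs w a in v | voltage gs w′ a in v′
    ... | just d | just d′ = shift-apart d d′ t apart
      (cong proj₂ (trans (sym (travel-lands w a t v)) (trans eq (travel-lands w′ a t v′))))

  labelling : ∀ {gs} (C : Certificate gs) →
              OrbitLabelling (map lift gs) (Label n (Certificate.#global C) (Certificate.#local C))
  labelling {gs} C = record
    { label           = label
    ; rep             = rep
    ; label-invariant = label-invariant
    ; label-rep       = label-rep
    ; reaches-rep     = reaches-rep
    }
    where
    open Certificate C
    label : A × Fin (suc n) → Label n #global #local
    label (a , t) = labelOf (kind a) t
    rep : Label n #global #local → A × Fin (suc n)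
    rep (inj₁ c)       = grep c , zero
    rep (inj₂ (c , t)) = lrep c , t
    label-invariant : ∀ {h} → h ∈ map lift gs → ∀ x → label (h x) ≡ label x
    label-invariant h∈ (a , t) with ∈-map⁻ lift h∈
    ... | σ , σ∈ , refl = labelOf-consistent (kind a) (volt σ a) _ t (All.lookup kind-consistent σ∈ a)
    label-rep : ∀ l → label (rep l) ≡ l
    label-rep (inj₁ c)       rewrite grep-kind c = refl
    label-rep (inj₂ (c , t)) rewrite lrep-kind c = refl
    descend : ∀ c t → Orbit (map lift gs) (grep c , t) (grep c , zero)
    descend c = <-weakInduction (λ t → Orbit (map lift gs) (grep c , t) (grep c , zero)) ε λ j below →
      subst (Orbit (map lift gs) (grep c , suc j))
            (trans (travel-lands gs (loop c) (grep c) (suc j) (proj₂ (loop-lowers c)))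
                   (cong (_, inject₁ j) (proj₁ (loop-lowers c))))
            (travel-orbit gs (loop c) _) ◅◅ below
    reaches-rep : ∀ x → Orbit (map lift gs) x (rep (label x))
    reaches-rep (a , t) with kind a | path-leads a
    ... | inj₁ c | reached =
      subst (λ b → Orbit (map lift gs) (a , t) (b , proj₂ (travel gs (path a) (a , t))))
            (trans (travel-base gs (path a) a t) reached) (travel-orbit gs (path a) (a , t))
      ◅◅ descend c _
    ... | inj₂ (c , d) | reached , volt-path =
      subst (Orbit (map lift gs) (a , t))
            (trans (travel-lands gs (path a) a t volt-path) (cong (_, shift d t) reached))
            (travel-orbit gs (path a) (a , t))

_≟ᵏ_ : ∀ {g l} → DecidableEquality (Kind g l)
_≟ᵏ_ = Sumₚ.≡-dec Finₚ._≟_ (Productₚ.≡-dec Finₚ._≟_ _≟ˢ_)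

consistent? : ∀ {g l} (κ : Kind g l) v κ′ → Dec (Consistent κ v κ′)
consistent? (inj₁ c)       v (inj₁ c′)        = c Finₚ.≟ c′
consistent? (inj₂ (c , d)) v (inj₂ (c′ , d′)) = (c Finₚ.≟ c′) ×-dec Maybeₚ.≡-dec _≟ˢ_ (v ⊕ d′) (just d)
consistent? (inj₁ _)       v (inj₂ _)         = no λ ()
consistent? (inj₂ _)       v (inj₁ _)         = no λ ()

-- Returned for a flag the search does not reach, which then fails the check.
someKind : ∀ g l → {{NonZero (g + l)}} → Kind g l
someKind (suc g) l       = inj₁ zero
someKind 0       (suc l) = inj₂ (zero , stay)

-- The kinds and paths are found by breadth-first search from the representatives; nothing about
-- the search is proved, its output is checked by a decision procedure.
module Certify {A : Set} (_≟_ : DecidableEquality A)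
               (∀? : {P : A → Set} → (∀ a → Dec (P a)) → Dec (∀ a → P a))
               (gs : List (Voltaged A)) (radius : ℕ) where
  private
    Node : Set
    Node = A × Word gs

    known : A → List Node → Bool
    known a = any (λ node → does (a ≟ proj₁ node))

    neighbours : Node → List Node
    neighbours (a , w) = map (λ i → perm (lookup gs i) a , i ∷ w) (allFin (length gs))

    fresh : List Node → List Node → List Node
    fresh seen []       = []
    fresh seen (x ∷ xs) with known (proj₁ x) seen
    ... | true  = fresh seen xs
    ... | false = x ∷ fresh (x ∷ seen) xs

    grow : ℕ → List Node → List Node → List Node
    grow 0       seen frontier = seen
    grow (suc k) seen frontier = grow k (new ++ seen) new
      where new : List Node
            new = fresh seen (concatMap neighbours frontier)

    -- The word stored with a node leads back to the centre because the maps are involutions.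
    ball : A → List Node
    ball centre = grow radius ((centre , []) ∷ []) ((centre , []) ∷ [])

  module _ {g l} (globals : Vec (A × Word gs) g) (locals : Vec A l) {{_ : NonZero (g + l)}} where
    private
      grep : Fin g → A
      grep c = proj₁ (Vec.lookup globals c)
      loop : Fin g → Word gs
      loop c = proj₂ (Vec.lookup globals c)
      lrep : Fin l → A
      lrep = Vec.lookup locals

      Table : Set
      Table = List (A × Kind g l × Word gs)

      table : Table
      table = concatMap global (allFin g) ++ concatMap local (allFin l)
        where
        global : Fin g → Table
        global c = map (λ (a , w) → a , inj₁ c , w) (ball (grep c))
        local : Fin l → Table
        local c = map (λ (a , w) → a , inj₂ (c , fromMaybe stay (voltage gs w a)) , w) (ball (lrep c))

      leads? : ∀ κ w a → Dec (Leads gs grep lrep κ w a)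
      leads? (inj₁ c)       w a = walk gs w a ≟ grep c
      leads? (inj₂ (c , d)) w a = (walk gs w a ≟ lrep c) ×-dec Maybeₚ.≡-dec _≟ˢ_ (voltage gs w a) (just d)

    -- The table is an argument so that it is computed only once when the check is evaluated.
    module _ (T : Table) where
      private
        entry : A → Maybe (Kind g l × Word gs)
        entry a = head (mapMaybe (λ (b , κw) → if does (a ≟ b) then just κw else nothing) T)
        kind : A → Kind g l
        kind a = fromMaybe (someKind g l) (Maybe.map proj₁ (entry a))
        path : A → Word gs
        path a = fromMaybe [] (Maybe.map proj₂ (entry a))

      Valid : Set
      Valid = All (λ σ → ∀ a → Consistent (kind a) (volt σ a) (kind (perm σ a))) gs
            × (∀ a → Leads gs grep lrep (kind a) (path a) a)
            × (∀ c → walk gs (loop c) (grep c) ≡ grep c × voltage gs (loop c) (grep c) ≡ just down)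
            × (∀ c → kind (grep c) ≡ inj₁ c)
            × (∀ c → kind (lrep c) ≡ inj₂ (c , stay))

      valid? : Dec Valid
      valid? = All.all? (λ σ → ∀? λ a → consistent? (kind a) (volt σ a) (kind (perm σ a))) gs
         ×-dec ∀? (λ a → leads? (kind a) (path a) a)
         ×-dec Finₚ.all? (λ c → (walk gs (loop c) (grep c) ≟ grep c)
                                 ×-dec Maybeₚ.≡-dec _≟ˢ_ (voltage gs (loop c) (grep c)) (just down))
         ×-dec Finₚ.all? (λ c → kind (grep c) ≟ᵏ inj₁ c)
         ×-dec Finₚ.all? (λ c → kind (lrep c) ≟ᵏ inj₂ (c , stay))

      certificate : Valid → Certificate gs
      certificate (consistent , leads , lowers , grep-kind , lrep-kind) = record
        { #global = g ; #local = l ; grep = grep ; lrep = lrep ; loop = loop ; kind = kind ; path = path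
        ; kind-consistent = consistent ; path-leads = leads ; loop-lowers = lowers
        ; grep-kind = grep-kind ; lrep-kind = lrep-kind }

    certify : {True (valid? table)} → Certificate gs
    certify {ok} = certificate table (toWitness ok)

-- Squares glued along their sides

-- A flag of a square is a side with one of its two ends; side i ends where side i + 1 starts.
SquareFlag : Set
SquareFlag = Fin 4 × Bool

BaseFlag : ℕ → Set
BaseFlag r = Fin r × SquareFlag

_≟ᵇ_ : DecidableEquality (BaseFlag r)
_≟ᵇ_ = Productₚ.≡-dec Finₚ._≟_ (Productₚ.≡-dec Finₚ._≟_ Boolₚ._≟_)

∀ᵇ? : {P : BaseFlag r → Set} → (∀ a → Dec (P a)) → Dec (∀ a → P a)
∀ᵇ? P? = map′ (λ h (b , i , e) → h b i e) (λ h b i e → h (b , i , e))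
               (Finₚ.all? λ b → Finₚ.all? λ i → all-Bool? λ e → P? (b , i , e))
  where
  all-Bool? : {Q : Bool → Set} → (∀ e → Dec (Q e)) → Dec (∀ e → Q e)
  all-Bool? Q? = map′ (λ { (f , t) false → f ; (f , t) true → t }) (λ h → h false , h true) (Q? false ×-dec Q? true)

flipEnd : BaseFlag r → BaseFlag r
flipEnd (b , i , e) = b , i , not e

turn : BaseFlag r → BaseFlag r
turn (b , i , false) = b , cpred i , true
turn (b , i , true)  = b , csuc i , false

-- A twisted gluing matches the start of one side with the start of the other.
record Side (r : ℕ) : Set where
  constructor side
  field
    square  : Fin r
    index   : Fin 4
    twisted : Bool
    shiftBy : Shift
open Side

Gluing : ℕ → Set
Gluing r = Vec (Vec (Side r) 4) r

partner : Gluing r → Fin r → Fin 4 → Side r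
partner G b i = Vec.lookup (Vec.lookup G b) i

glue : Gluing r → BaseFlag r → BaseFlag r
glue G (b , i , e) = square (partner G b i) , index (partner G b i) , e xor twisted (partner G b i)

σ₀ σ₁ : Voltaged (BaseFlag r)
σ₀ = record { perm = flipEnd ; volt = λ _ → stay }
σ₁ = record { perm = turn ; volt = λ _ → stay }

σ₂ : Gluing r → Voltaged (BaseFlag r)
σ₂ G = record { perm = glue G ; volt = λ (b , i , _) → shiftBy (partner G b i) }

Reciprocal : Gluing r → Fin r → Fin 4 → Set
Reciprocal {r} G b i = partner G (square s) (index s) ≡ side b i (twisted s) (shiftBy s ⁻¹)
                 × (square s , index s) ≢ (b , i)
  where s : Side r
        s = partner G b i

ValidGluing : Gluing r → Set
ValidGluing G = ∀ b i → Reciprocal G b i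

validGluing? : (G : Gluing r) → Dec (ValidGluing G)
validGluing? G = Finₚ.all? λ b → Finₚ.all? λ i →
  side-≟ (partner G (square (partner G b i)) (index (partner G b i))) _
  ×-dec ¬? (Productₚ.≡-dec Finₚ._≟_ Finₚ._≟_ _ _)
  where
  side-≟ : DecidableEquality (Side r)
  side-≟ (side b i τ d) (side b′ i′ τ′ d′) =
    map′ (λ { (refl , refl , refl , refl) → refl }) (λ { refl → refl , refl , refl , refl })
         (b Finₚ.≟ b′ ×-dec i Finₚ.≟ i′ ×-dec τ Boolₚ.≟ τ′ ×-dec d ≟ˢ d′)

module _ (G : Gluing r) (valid : ValidGluing G) where
  σ₂-involution : VoltagedInvolution (σ₂ G)
  σ₂-involution (b , i , e) =
    trans (cong (λ s′ → square s′ , index s′ , (e xor twisted s) xor twisted s′) back)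
          (cong (λ x → b , i , x) (trans (Boolₚ.xor-assoc e (twisted s) (twisted s))
                                         (trans (cong (e xor_) (Boolₚ.xor-same (twisted s))) (Boolₚ.xor-identityʳ e))))
    , cong shiftBy back
    where
    s : Side r
    s = partner G b i
    back : partner G (square s) (index s) ≡ side b i (twisted s) (shiftBy s ⁻¹)
    back = proj₁ (valid b i)

  glue-irrefl : ∀ a → glue G a ≢ a
  glue-irrefl (b , i , e) eq = proj₂ (valid b i) (cong (λ (b′ , i′ , _) → b′ , i′) eq)

  flipEnd∘glue-irrefl : ∀ a → flipEnd (glue G a) ≢ a
  flipEnd∘glue-irrefl (b , i , e) eq = proj₂ (valid b i) (cong (λ (b′ , i′ , _) → b′ , i′) eq)

flipEnd∘glue : (G : Gluing r) → ∀ a → flipEnd (glue G a) ≡ glue G (flipEnd a)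
flipEnd∘glue G (b , i , e) = cong (λ x → _ , _ , x) (Boolₚ.not-distribˡ-xor e _)

σ₀-involution : VoltagedInvolution (σ₀ {r})
σ₀-involution (b , i , e) = cong (λ x → b , i , x) (Boolₚ.not-involutive e) , refl

σ₁-involution : VoltagedInvolution (σ₁ {r})
σ₁-involution (b , i , false) = cong (λ j → b , j , false) (csuc-cpred i) , refl
σ₁-involution (b , i , true)  = cong (λ j → b , j , true) (cpred-csuc i) , refl

flipEnd-irrefl : (a : BaseFlag r) → flipEnd a ≢ a
flipEnd-irrefl (b , i , false) ()
flipEnd-irrefl (b , i , true)  ()

turn-irrefl : (a : BaseFlag r) → turn a ≢ a
turn-irrefl (b , i , false) ()
turn-irrefl (b , i , true)  ()

cornerFlag : Fin 4 → BaseFlag r → BaseFlag r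
cornerFlag i a = fold a (turn ∘ flipEnd) (toℕ i)

xor-not-≢ : ∀ x e → x xor not e ≢ x xor e
xor-not-≢ x e eq = Boolₚ.not-¬ refl (sym (trans (Boolₚ.not-distribʳ-xor x e) eq))

parity : Fin 4 → Bool
parity i = fold false not (toℕ i)

parity-csuc : ∀ i → parity (csuc i) ≡ not (parity i)
parity-csuc 0F = refl
parity-csuc 1F = refl
parity-csuc 2F = refl
parity-csuc 3F = refl

parity-cpred : ∀ i → parity (cpred i) ≡ not (parity i)
parity-cpred 0F = refl
parity-cpred 1F = refl
parity-cpred 2F = refl
parity-cpred 3F = refl

-- Inside square b the arc joins the midpoints of the two sides i with parity i ≢ arcs b.
selection : (Fin r → Bool) → BaseFlag r → Bool
selection arcs (b , i , _) = arcs b xor parity i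

selection-turn : ∀ arcs (a : BaseFlag r) → selection arcs (turn a) ≢ selection arcs a
selection-turn arcs (b , i , false) = xor-not-≢ (arcs b) (parity i) ∘ trans (cong (arcs b xor_) (sym (parity-cpred i)))
selection-turn arcs (b , i , true)  = xor-not-≢ (arcs b) (parity i) ∘ trans (cong (arcs b xor_) (sym (parity-csuc i)))

-- orient b records whether square b is reflected.
colouring : (Fin r → Bool) → BaseFlag r → Bool
colouring orient (b , _ , e) = orient b xor e

colouring-flipEnd : ∀ orient (a : BaseFlag r) → colouring orient (flipEnd a) ≢ colouring orient a
colouring-flipEnd orient (b , i , e) = xor-not-≢ (orient b) e

colouring-turn : ∀ orient (a : BaseFlag r) → colouring orient (turn a) ≢ colouring orient a
colouring-turn orient (b , i , false) = xor-not-≢ (orient b) false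
colouring-turn orient (b , i , true)  = xor-not-≢ (orient b) true

GlueFlips : Gluing r → (BaseFlag r → Bool) → Set
GlueFlips G c = ∀ a → c (glue G a) ≢ c a

glueFlips? : (G : Gluing r) (c : BaseFlag r → Bool) → Dec (GlueFlips G c)
glueFlips? G c = ∀ᵇ? λ a → ¬? (c (glue G a) Boolₚ.≟ c a)

module SquareCover (n : ℕ) {r : ℕ} (G : Gluing r) (valid : ValidGluing G) where
  open Cover n

  Point : Set
  Point = BaseFlag r × Fin (suc n)

  squareFlag↔ : SquareFlag ↔ Fin 8
  squareFlag↔ = ↔-sym (↔-trans Finₚ.*↔× (↔-refl ×-↔ Finₚ.2↔Bool))

  point↔ : Point ↔ Fin (r * 8 * suc n)
  point↔ = ↔-sym (↔-trans Finₚ.*↔× (↔-trans Finₚ.*↔× (↔-refl ×-↔ ↔-sym squareFlag↔) ×-↔ ↔-refl))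

  labels↔ : ∀ {g l} → Label n g l ↔ Fin (g + l * suc n)
  labels↔ {g} {l} = ↔-sym (↔-trans (Finₚ.+↔⊎ {g} {l * suc n}) (↔-refl ⊎-↔ Finₚ.*↔× {l} {suc n}))

  open Transport point↔ public
  open Inverse point↔ using (to; from; strictlyInverseˡ; strictlyInverseʳ)

  vertexGens edgeGens tileGens allGens : List (Voltaged (BaseFlag r))
  vertexGens = σ₁ ∷ σ₂ G ∷ []
  edgeGens   = σ₀ ∷ σ₂ G ∷ []
  tileGens   = σ₀ ∷ σ₁ ∷ []
  allGens    = σ₀ ∷ σ₁ ∷ σ₂ G ∷ []

  module _ {gs : List (Voltaged (BaseFlag r))} where
    open Certify _≟ᵇ_ ∀ᵇ? gs (r * 8) public using (certify)

  private
    inv₀ : VoltagedInvolution (σ₀ {r})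
    inv₀ = σ₀-involution
    inv₁ : VoltagedInvolution (σ₁ {r})
    inv₁ = σ₁-involution
    inv₂ : VoltagedInvolution (σ₂ G)
    inv₂ = σ₂-involution G valid

  count : ∀ {gs} → All VoltagedInvolution gs → (C : Certificate gs) →
          ClassCount (Orb (map conj (map lift gs))) (Certificate.#global C + Certificate.#local C * suc n)
  count invs C = classCount (lifts-involutive invs) (labelling C) labels↔

  spin : Fin 6 → Word vertexGens
  spin k = take (toℕ k) (0 ∷ 1 ∷ 0 ∷ 1 ∷ 0 ∷ [])

  -- The first six flags met when turning around a vertex are distinct.
  SixAround : Set
  SixAround = ∀ a (k k′ : Fin 6) → k ≡ k′ ⊎ Separated vertexGens (spin k) (spin k′) a

  CornersApart : ∀ {gs : List (Voltaged (BaseFlag r))} → Certificate gs → Set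
  CornersApart C = ∀ a (i j : Fin 4) → i ≡ j ⊎ KindsApart n (kind (cornerFlag i a)) (kind (cornerFlag j a))
    where open Certificate C

  voltagesApart? : ∀ m m′ → Dec (VoltagesApart n m m′)
  voltagesApart? (just d) (just d′) = levelsApart n d d′ Boolₚ.≟ true
  voltagesApart? (just _) nothing   = no λ ()
  voltagesApart? nothing  _         = no λ ()

  kindsApart? : ∀ {g l} (κ κ′ : Kind g l) → Dec (KindsApart n κ κ′)
  kindsApart? (inj₁ c)       (inj₁ c′)        = ¬? (c Finₚ.≟ c′)
  kindsApart? (inj₂ (c , d)) (inj₂ (c′ , d′)) = ¬? (c Finₚ.≟ c′) ⊎-dec levelsApart n d d′ Boolₚ.≟ true
  kindsApart? (inj₁ _)       (inj₂ _)         = yes tt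
  kindsApart? (inj₂ _)       (inj₁ _)         = yes tt

  sixAround? : Dec SixAround
  sixAround? = ∀ᵇ? λ a → Finₚ.all? λ k → Finₚ.all? λ k′ → k Finₚ.≟ k′ ⊎-dec
    (¬? (walk vertexGens (spin k) a ≟ᵇ walk vertexGens (spin k′) a)
     ⊎-dec voltagesApart? (voltage vertexGens (spin k) a) (voltage vertexGens (spin k′) a))

  cornersApart? : ∀ {gs : List (Voltaged (BaseFlag r))} (C : Certificate gs) → Dec (CornersApart C)
  cornersApart? C = ∀ᵇ? λ a → Finₚ.all? λ i → Finₚ.all? λ j → i Finₚ.≟ j ⊎-dec
    kindsApart? (kind (cornerFlag i a)) (kind (cornerFlag j a))
    where open Certificate C

  module Connected (whole : Certificate allGens)
                   (single : Certificate.#global whole + Certificate.#local whole * suc n ≡ 1) where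
    M : FlagMap (r * 8 * suc n)
    M = record
      { s0 = conj (lift σ₀) ; s1 = conj (lift σ₁) ; s2 = conj (lift (σ₂ G))
      ; s0-invol = conj-involutive (lift σ₀) (lift-involutive σ₀ inv₀)
      ; s1-invol = conj-involutive (lift σ₁) (lift-involutive σ₁ inv₁)
      ; s2-invol = conj-involutive (lift (σ₂ G)) (lift-involutive (σ₂ G) inv₂)
      ; s0-fpf = conj-irrefl (lift σ₀) λ (a , t) → flipEnd-irrefl a ∘ cong proj₁
      ; s1-fpf = conj-irrefl (lift σ₁) λ (a , t) → turn-irrefl a ∘ cong proj₁
      ; s2-fpf = conj-irrefl (lift (σ₂ G)) λ (a , t) → glue-irrefl G valid a ∘ cong proj₁
      ; s02-comm = conj-commute (lift σ₀) (lift (σ₂ G)) λ (a , t) →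
                     cong (_, shift (volt (σ₂ G) a) t) (flipEnd∘glue G a)
      ; s02-fpf = conj-∘-irrefl (lift σ₀) (lift (σ₂ G)) λ (a , t) → flipEnd∘glue-irrefl G valid a ∘ cong proj₁
      ; connected = single-class⇒related (subst (ClassCount _) single (count (inv₀ ∷ inv₁ ∷ inv₂ ∷ []) whole))
      }
      where
      single-class⇒related : ∀ {K} {R : Fin K → Fin K → Set} → ClassCount R 1 → ∀ i j → R i j
      single-class⇒related (c , _ , iff) i j = Equivalence.to (iff i j) (unique (c i) (c j))
        where unique : (x y : Fin 1) → x ≡ y
              unique zero zero = refl

    vertexCount : (V : Certificate vertexGens) →
                  ClassCount (SameVertex M) (Certificate.#global V + Certificate.#local V * suc n)
    vertexCount = count (inv₁ ∷ inv₂ ∷ [])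

    edgeCount : (E : Certificate edgeGens) →
                ClassCount (SameEdge M) (Certificate.#global E + Certificate.#local E * suc n)
    edgeCount = count (inv₀ ∷ inv₂ ∷ [])

    tileOf : Point → Fin r × Fin (suc n)
    tileOf ((b , _) , t) = b , t

    tileLabelling : OrbitLabelling (map lift tileGens) (Fin r × Fin (suc n))
    tileLabelling = record
      { label           = tileOf
      ; rep             = λ (b , t) → (b , 0 , false) , t
      ; label-invariant = invariant
      ; label-rep       = λ _ → refl
      ; reaches-rep     = reaches-start
      }
      where
      invariant : ∀ {h} → h ∈ map lift tileGens → ∀ x → tileOf (h x) ≡ tileOf x
      invariant (here refl)         ((b , i , e) , t)     = refl
      invariant (there (here refl)) ((b , i , false) , t) = refl
      invariant (there (here refl)) ((b , i , true) , t)  = refl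

      side-start : ∀ b i t → Orbit (map lift tileGens) ((b , i , false) , t) ((b , 0 , false) , t)
      side-start b i t = <-weakInduction (λ i → Orbit (map lift tileGens) ((b , i , false) , t) ((b , 0 , false) , t))
        ε (λ j next → (lift σ₁ , there (here refl) , refl) ◅ (lift σ₀ , here refl , refl) ◅ next) i

      reaches-start : ∀ x → Orbit (map lift tileGens) x ((proj₁ (proj₁ x) , 0 , false) , proj₂ x)
      reaches-start ((b , i , false) , t) = side-start b i t
      reaches-start ((b , i , true) , t)  = (lift σ₀ , here refl , refl) ◅ side-start b i t

    tileCount : ClassCount (SameTile M) (r * suc n)
    tileCount = classCount (lifts-involutive (inv₀ ∷ inv₁ ∷ [])) tileLabelling (↔-sym Finₚ.*↔×)

    quadrilateral : Quadrilateral M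
    quadrilateral f = corner , corner-injective , members
      where
      b : Fin r
      b = proj₁ (proj₁ (from f))
      t : Fin (suc n)
      t = proj₂ (from f)
      corner : Fin 8 → Fin (r * 8 * suc n)
      corner k = to ((b , Inverse.from squareFlag↔ k) , t)
      corner-injective : Injective _≡_ _≡_ corner
      corner-injective eq = Injection.injective (↔⇒↣ (↔-sym squareFlag↔)) (cong (proj₂ ∘ proj₁) (to-injective eq))
      sameTile⇔ : ∀ i j → SameTile M i j ⇔ tileOf (from i) ≡ tileOf (from j)
      sameTile⇔ = orb⇔label (lifts-involutive (inv₀ ∷ inv₁ ∷ [])) tileLabelling
      members : ∀ y → SameTile M f y ⇔ ∃ λ k → corner k ≡ y
      members y = mk⇔ into out
        where
        into : SameTile M f y → ∃ λ k → corner k ≡ y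
        into same = Inverse.to squareFlag↔ φ , (begin
          to ((b , Inverse.from squareFlag↔ (Inverse.to squareFlag↔ φ)) , t)
            ≡⟨ cong (λ φ′ → to ((b , φ′) , t)) (Inverse.strictlyInverseʳ squareFlag↔ φ) ⟩
          to ((b , φ) , t)
            ≡⟨ cong (λ (b′ , t′) → to ((b′ , φ) , t′)) (Equivalence.to (sameTile⇔ f y) same) ⟩
          to (from y)
            ≡⟨ strictlyInverseˡ y ⟩
          y ∎)
          where φ : SquareFlag
                φ = proj₂ (proj₁ (from y))
        out : (∃ λ k → corner k ≡ y) → SameTile M f y
        out (k , refl) = Equivalence.from (sameTile⇔ f (corner k))
          (sym (cong tileOf (strictlyInverseʳ ((b , Inverse.from squareFlag↔ k) , t))))

    isTiling : SixAround → IsTiling M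
    isTiling six = degree , faceSize
      where
      degree : ∀ f m → ClassSize (SameVertex M) f m → 6 ≤ m
      degree f m size = classSize-≥ {R = SameVertex M} {f} size around around-injective around-related
        where
        x : Point
        x = from f
        around : Fin 6 → Fin (r * 8 * suc n)
        around k = to (travel vertexGens (spin k) x)
        around-injective : Injective _≡_ _≡_ around
        around-injective {k} {k′} eq with six (proj₁ x) k k′
        ... | inj₁ k≡k′ = k≡k′
        ... | inj₂ sep  = ⊥-elim (separated⇒distinct vertexGens (spin k) (spin k′) (proj₁ x) (proj₂ x) sep (to-injective eq))
        around-related : ∀ k → SameVertex M f (around k)
        around-related k = subst (λ i → SameVertex M i (around k)) (strictlyInverseˡ f)
                                 (orbit-to (travel-orbit vertexGens (spin k) x))
      faceSize : ∀ f m → ClassSize (SameTile M) f m → 6 ≤ m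
      faceSize f m size with quadrilateral f
      ... | corner , corner-injective , members =
        ℕₚ.≤-trans (ℕₚ.m≤m+n 6 2)
          (classSize-≥ {R = SameTile M} {f} size corner corner-injective λ k → Equivalence.from (members (corner k)) (k , refl))

    ρ-to : ∀ k a t → ρ^ M k (to (a , t)) ≡ to (fold a (turn ∘ flipEnd) k , t)
    ρ-to 0       a t = refl
    ρ-to (suc k) a t = trans (cong (ρ M) (ρ-to k a t))
      (trans (cong (conj (lift σ₁)) (conj-to (lift σ₀) x)) (conj-to (lift σ₁) (lift σ₀ x)))
      where x : Point
            x = fold a (turn ∘ flipEnd) k , t

    corners-not-related : ∀ {gs : List (Voltaged (BaseFlag r))} → All VoltagedInvolution gs → (C : Certificate gs) → CornersApart C →
                          ∀ a t i j → i ≢ j →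
                          ¬ Orb (map conj (map lift gs)) (ρ^ M (toℕ i) (to (a , t))) (ρ^ M (toℕ j) (to (a , t)))
    corners-not-related {gs} invs C apart a t i j i≢j related with apart a i j
    ... | inj₁ i≡j    = i≢j i≡j
    ... | inj₂ kinds≢ = labelOf-apart _ _ t kinds≢ (begin
      labelOf (kind (cornerFlag i a)) t       ≡⟨ cong label (sym (strictlyInverseʳ _)) ⟩
      label (from (to (cornerFlag i a , t)))  ≡⟨ Equivalence.to (orb⇔label (lifts-involutive invs) (labelling C) _ _)
                                                   (subst₂ (Orb (map conj (map lift gs))) (ρ-to (toℕ i) a t) (ρ-to (toℕ j) a t) related) ⟩
      label (from (to (cornerFlag j a , t)))  ≡⟨ cong label (strictlyInverseʳ _) ⟩
      labelOf (kind (cornerFlag j a)) t       ∎)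
      where open Certificate C
            open OrbitLabelling (labelling C)

    nondegenerate : (V : Certificate vertexGens) (E : Certificate edgeGens) → CornersApart V → CornersApart E →
                    AllTilesNonDegenerate M
    nondegenerate V E apartV apartE f = subst (NonDegenerateTile M) (strictlyInverseˡ f) λ i j i≢j →
      corners-not-related (inv₁ ∷ inv₂ ∷ []) V apartV a t i j i≢j ,
      corners-not-related (inv₀ ∷ inv₂ ∷ []) E apartE a t i j i≢j
      where a : BaseFlag r
            a = proj₁ (from f)
            t : Fin (suc n)
            t = proj₂ (from f)

    subdivisible : (arcs : Fin r → Bool) → GlueFlips G (selection arcs) → Subdivisible M
    subdivisible arcs matching = sel , keeps₀ , flips₁ , ρ²-preserves M sel keeps₀ flips₁ , flips₂
      where
      sel : Fin (r * 8 * suc n) → Bool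
      sel = selection arcs ∘ proj₁ ∘ from
      keeps₀ : ∀ f → sel (conj (lift σ₀) f) ≡ sel f
      keeps₀ f = cong (selection arcs ∘ proj₁) (from-conj (lift σ₀) f)
      flips₁ : ∀ f → sel (conj (lift σ₁) f) ≢ sel f
      flips₁ f = selection-turn arcs (proj₁ (from f)) ∘ trans (sym (cong (selection arcs ∘ proj₁) (from-conj (lift σ₁) f)))
      flips₂ : ∀ f → sel (conj (lift (σ₂ G)) f) ≢ sel f
      flips₂ f = matching (proj₁ (from f)) ∘ trans (sym (cong (selection arcs ∘ proj₁) (from-conj (lift (σ₂ G)) f)))

    isOrientable : (orient : Fin r → Bool) → GlueFlips G (colouring orient) → Orientable M
    isOrientable orient coherent = colour , flips₀ , flips₁ , flips₂
      where
      colour : Fin (r * 8 * suc n) → Bool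
      colour = colouring orient ∘ proj₁ ∘ from
      flips₀ : ∀ f → colour (conj (lift σ₀) f) ≢ colour f
      flips₀ f = colouring-flipEnd orient (proj₁ (from f)) ∘ trans (sym (cong (colouring orient ∘ proj₁) (from-conj (lift σ₀) f)))
      flips₁ : ∀ f → colour (conj (lift σ₁) f) ≢ colour f
      flips₁ f = colouring-turn orient (proj₁ (from f)) ∘ trans (sym (cong (colouring orient ∘ proj₁) (from-conj (lift σ₁) f)))
      flips₂ : ∀ f → colour (conj (lift (σ₂ G)) f) ≢ colour f
      flips₂ f = coherent (proj₁ (from f)) ∘ trans (sym (cong (colouring orient ∘ proj₁) (from-conj (lift (σ₂ G)) f)))

    notOrientable : (w : Word allGens) (a : BaseFlag r) → walk allGens w a ≡ a → voltage allGens w a ≡ just stay →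
                    fold false not (length w) ≡ true → ¬ Orientable M
    notOrientable w a closed trivial odd (c , flips₀ , flips₁ , flips₂) = Boolₚ.not-¬ refl (begin
      colour x                                ≡⟨ cong colour (sym (trans (travel-lands allGens w a 0 trivial) (cong (_, 0) closed))) ⟩
      colour (travel allGens w x)             ≡⟨ along w x ⟩
      fold false not (length w) xor colour x  ≡⟨ cong (_xor colour x) odd ⟩
      not (colour x)                          ∎)
      where
      x : Point
      x = a , 0
      colour : Point → Bool
      colour = c ∘ to
      flips : ∀ i y → colour (lift (lookup allGens i) y) ≡ not (colour y)
      flips 0F y = Boolₚ.¬-not (flips₀ (to y) ∘ trans (cong c (conj-to (lift σ₀) y)))
      flips 1F y = Boolₚ.¬-not (flips₁ (to y) ∘ trans (cong c (conj-to (lift σ₁) y)))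
      flips 2F y = Boolₚ.¬-not (flips₂ (to y) ∘ trans (cong c (conj-to (lift (σ₂ G)) y)))
      along : ∀ w y → colour (travel allGens w y) ≡ fold false not (length w) xor colour y
      along []      y = refl
      along (i ∷ w) y = begin
        colour (travel allGens w (lift (lookup allGens i) y))            ≡⟨ along w _ ⟩
        fold false not (length w) xor colour (lift (lookup allGens i) y) ≡⟨ cong (fold false not (length w) xor_) (flips i y) ⟩
        fold false not (length w) xor not (colour y)                     ≡⟨ sym (Boolₚ.not-distribʳ-xor (fold false not (length w)) (colour y)) ⟩
        not (fold false not (length w) xor colour y)                     ≡⟨ Boolₚ.not-distribˡ-xor (fold false not (length w)) (colour y) ⟩
        not (fold false not (length w)) xor colour y                     ∎

    tilingProperties : (V : Certificate vertexGens) (E : Certificate edgeGens) (arcs : Fin r → Bool) →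
                       {True (sixAround? ×-dec cornersApart? V ×-dec cornersApart? E ×-dec glueFlips? G (selection arcs))} →
                       IsTiling M × Quadrilateral M × Subdivisible M × AllTilesNonDegenerate M
    tilingProperties V E arcs {ok} = from-checks (toWitness ok)
      where
      from-checks : SixAround × CornersApart V × CornersApart E × GlueFlips G (selection arcs) →
                    IsTiling M × Quadrilateral M × Subdivisible M × AllTilesNonDegenerate M
      from-checks (six , apartV , apartE , matching) =
        isTiling six , quadrilateral , subdivisible arcs matching , nondegenerate V E apartV apartE

-- The four families

Realisation : Surface → Set
Realisation S = Σ ℕ λ m → Σ (FlagMap (suc m)) λ M →
  (M IsMapOn S) × IsTiling M × Quadrilateral M × Subdivisible M × AllTilesNonDegenerate M

module Cube where
  cube : Gluing 6
  cube =
      (side 2 3 true stay ∷ side 5 3 true stay ∷ side 3 0 true stay ∷ side 4 0 true stay ∷ [])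
    ∷ (side 4 2 true stay ∷ side 3 2 true stay ∷ side 5 1 true stay ∷ side 2 1 true stay ∷ [])
    ∷ (side 4 3 true stay ∷ side 1 3 true stay ∷ side 5 0 true stay ∷ side 0 0 true stay ∷ [])
    ∷ (side 0 2 true stay ∷ side 5 2 true stay ∷ side 1 1 true stay ∷ side 4 1 true stay ∷ [])
    ∷ (side 0 3 true stay ∷ side 3 3 true stay ∷ side 1 0 true stay ∷ side 2 0 true stay ∷ [])
    ∷ (side 2 2 true stay ∷ side 1 2 true stay ∷ side 3 1 true stay ∷ side 0 1 true stay ∷ [])
    ∷ []

  open SquareCover 0 cube (from-yes (validGluing? cube)) public

  vertices : Certificate vertexGens
  vertices = certify [] ((0 , 0 , false) ∷ (0 , 0 , true) ∷ (0 , 1 , true) ∷ (0 , 2 , true)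
                       ∷ (1 , 0 , false) ∷ (1 , 0 , true) ∷ (1 , 1 , true) ∷ (1 , 2 , true) ∷ [])

  edges : Certificate edgeGens
  edges = certify [] ((0 , 0 , false) ∷ (0 , 1 , false) ∷ (0 , 2 , false) ∷ (0 , 3 , false)
                    ∷ (1 , 0 , false) ∷ (1 , 1 , false) ∷ (1 , 2 , false) ∷ (1 , 3 , false)
                    ∷ (2 , 0 , false) ∷ (2 , 2 , false) ∷ (3 , 1 , false) ∷ (3 , 3 , false) ∷ [])

  open Connected (certify [] ((0 , 0 , false) ∷ [])) refl public

  arcs orient : Fin 6 → Bool
  arcs   = Vec.lookup (false ∷ true ∷ false ∷ true ∷ false ∷ true ∷ [])
  orient = λ _ → false

sphere : Realisation (orientable 0)
sphere = _ , M
  , (_ , _ , _ , vertexCount vertices , edgeCount edges , tileCount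
    , isOrientable orient (from-yes (glueFlips? cube (colouring orient))) , refl)
  , tilingProperties vertices edges arcs
  where open Cube

module Hemicube where
  hemicube : Gluing 3
  hemicube =
      (side 1 3 true stay ∷ side 2 2 false stay ∷ side 1 1 false stay ∷ side 2 0 true stay ∷ [])
    ∷ (side 2 3 true stay ∷ side 0 2 false stay ∷ side 2 1 false stay ∷ side 0 0 true stay ∷ [])
    ∷ (side 0 3 true stay ∷ side 1 2 false stay ∷ side 0 1 false stay ∷ side 1 0 true stay ∷ [])
    ∷ []

  open SquareCover 0 hemicube (from-yes (validGluing? hemicube)) public

  vertices : Certificate vertexGens
  vertices = certify [] ((0 , 0 , false) ∷ (0 , 0 , true) ∷ (0 , 1 , true) ∷ (0 , 2 , true) ∷ [])

  edges : Certificate edgeGens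
  edges = certify [] ((0 , 0 , false) ∷ (0 , 1 , false) ∷ (0 , 2 , false) ∷ (0 , 3 , false)
                    ∷ (1 , 0 , false) ∷ (1 , 2 , false) ∷ [])

  open Connected (certify [] ((0 , 0 , false) ∷ [])) refl public

projectivePlane : Realisation (nonorientable 0)
projectivePlane = _ , M
  , (_ , _ , _ , vertexCount vertices , edgeCount edges , tileCount
    , notOrientable (2 ∷ 1 ∷ 0 ∷ 1 ∷ 2 ∷ 1 ∷ 0 ∷ 1 ∷ 0 ∷ []) (0 , 0 , false) refl refl refl , refl)
  , tilingProperties vertices edges (λ _ → false)
  where open Hemicube

-- Two squares glued into a sphere; going once around any of its four corners shifts the level.
pillow : Gluing 2
pillow =
    (side 1 3 false down ∷ side 1 0 false stay ∷ side 1 1 false up ∷ side 1 2 false stay ∷ [])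
  ∷ (side 0 1 false stay ∷ side 0 2 false down ∷ side 0 3 false stay ∷ side 0 0 false up ∷ [])
  ∷ []

module Pillow (g : ℕ) where
  open SquareCover (suc g) pillow (from-yes (validGluing? pillow)) public

  vertices : Certificate vertexGens
  vertices = certify (((0 , 0 , false) , 1 ∷ 0 ∷ 1 ∷ 0 ∷ []) ∷ ((0 , 0 , true) , 1 ∷ 0 ∷ 1 ∷ 0 ∷ [])
                    ∷ ((0 , 1 , true) , 1 ∷ 0 ∷ 1 ∷ 0 ∷ []) ∷ ((0 , 2 , true) , 0 ∷ 1 ∷ 0 ∷ 1 ∷ []) ∷ []) []

  edges : Certificate edgeGens
  edges = certify [] ((0 , 0 , false) ∷ (0 , 1 , false) ∷ (0 , 2 , false) ∷ (0 , 3 , false) ∷ [])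

  open Connected (certify (((0 , 0 , false) , 2 ∷ 1 ∷ 2 ∷ 1 ∷ []) ∷ []) []) refl public

  orient : Fin 2 → Bool
  orient = Vec.lookup (false ∷ true ∷ [])

orientableSurface : ∀ g → Realisation (orientable (suc g))
orientableSurface g = _ , M
  , (_ , _ , _ , vertexCount vertices , edgeCount edges , tileCount
    , isOrientable orient (from-yes (glueFlips? pillow (colouring orient))) , euler g)
  , tilingProperties vertices edges (λ _ → false)
  where
  open Pillow g
  euler : ∀ g → 4 + 0 * suc (suc g) + 2 * suc (suc g) + 2 * suc g ≡ 0 + 4 * suc (suc g) + 2
  euler = solve-∀

-- Two squares glued into a projective plane; going around two of its three corners shifts the level.
twistedPillow : Gluing 2
twistedPillow =
    (side 1 3 false down ∷ side 1 0 false stay ∷ side 1 1 false up ∷ side 1 2 true stay ∷ [])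
  ∷ (side 0 1 false stay ∷ side 0 2 false down ∷ side 0 3 true stay ∷ side 0 0 false up ∷ [])
  ∷ []

module TwistedPillow (k : ℕ) where
  open SquareCover (suc k) twistedPillow (from-yes (validGluing? twistedPillow)) public

  vertices : Certificate vertexGens
  vertices = certify (((0 , 0 , true) , 1 ∷ 0 ∷ 1 ∷ 0 ∷ []) ∷ ((0 , 1 , true) , 1 ∷ 0 ∷ 1 ∷ 0 ∷ []) ∷ [])
                     ((0 , 0 , false) ∷ [])

  edges : Certificate edgeGens
  edges = certify [] ((0 , 0 , false) ∷ (0 , 1 , false) ∷ (0 , 2 , false) ∷ (0 , 3 , false) ∷ [])

  open Connected (certify (((0 , 0 , false) , 2 ∷ 1 ∷ 2 ∷ 0 ∷ 1 ∷ []) ∷ []) []) refl public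

nonorientableSurface : ∀ k → Realisation (nonorientable (suc k))
nonorientableSurface k = _ , M
  , (_ , _ , _ , vertexCount vertices , edgeCount edges , tileCount
    , notOrientable (1 ∷ 2 ∷ 1 ∷ 0 ∷ 1 ∷ 2 ∷ 0 ∷ 1 ∷ 0 ∷ []) (0 , 0 , false) refl refl refl , euler k)
  , tilingProperties vertices edges (λ _ → false)
  where
  open TwistedPillow k
  euler : ∀ k → 2 + 1 * suc (suc k) + 2 * suc (suc k) + suc (suc k) ≡ 0 + 4 * suc (suc k) + 2
  euler = solve-∀

proposition2p1 : (S : Surface) →
    Σ ℕ λ m → Σ (FlagMap (suc m)) λ M →
      (M IsMapOn S) × IsTiling M × Quadrilateral M ×
      Subdivisible M × AllTilesNonDegenerate M
proposition2p1 (orientable 0)          = sphere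
proposition2p1 (orientable (suc g))    = orientableSurface g
proposition2p1 (nonorientable 0)       = projectivePlane
proposition2p1 (nonorientable (suc k)) = nonorientableSurface k
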